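{- $Y_v\simeq_{enf}\Theta_v$, where $Y_v=\lambda x.\Xi_v\Xi_v$ with $\Xi_v=\lambda z.x(\lambda y.zzy)$, and $\Theta_v=(\lambda z.\lambda x.x(\lambda y.zzxy))(\lambda z.\lambda x.x(\lambda y.zzxy))$.
   Context: Plotkin terms $t::=v\mid tu$, values $v::=x\mid\lambda x.t$. Root rule $(\lambda x.t)v\mapsto t\{x:=v\}$ ($v$ value). Left contexts $L::=\langle\cdot\rangle\mid vL\mid Lt$; left reduction $\to_l$: closure under left contexts. $t\Downarrow_ln$: $t\to_l^*n$ with $n$ $\to_l$-normal. Enf simulation: $R$ such that whenever $tRt'$ one of: $t$ has no $\to_l$-normal form; $t\Downarrow_lx$ and $t'\Downarrow_lx$; $t\Downarrow_l\lambda x.t_1$, $t'\Downarrow_l\lambda x.t_1'$, $t_1Rt_1'$; $t\Downarrow_lL\langle xv\rangle$, $t'\Downarrow_lL'\langle xv'\rangle$ with $vRv'$ and $L\langle z\rangle RL'\langle z\rangle$, $z$ not free in $L,L'$. Enf bisimilarity: $t\simeq_{enf}u$ iff there is $R$ with $tRu$ such that $R$ and its converse are enf simulations. -}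

module Defs where

open import Data.Nat using (ℕ; zero; suc)
open import Data.Product using (Σ; ∃; ∃-syntax; _×_; _,_)
open import Data.Sum using (_⊎_)
open import Relation.Nullary using (¬_)
open import Relation.Binary.PropositionalEquality using (_≡_)
open import Relation.Binary.Construct.Closure.ReflexiveTransitive using (Star)

-- Untyped λ-terms up to α-equivalence, de Bruijn indices (var 0 = innermost binder).
data Term : Set where
  var : ℕ → Term
  lam : Term → Term
  app : Term → Term → Term

data Value : Term → Set where
  var : (n : ℕ) → Value (var n)
  lam : (t : Term) → Value (lam t)

ext : (ℕ → ℕ) → ℕ → ℕ
ext ρ zero = zero
ext ρ (suc n) = suc (ρ n)

rename : (ℕ → ℕ) → Term → Term
rename ρ (var n) = var (ρ n)
rename ρ (lam t) = lam (rename (ext ρ) t)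
rename ρ (app t u) = app (rename ρ t) (rename ρ u)

exts : (ℕ → Term) → ℕ → Term
exts σ zero = var zero
exts σ (suc n) = rename suc (σ n)

subst : (ℕ → Term) → Term → Term
subst σ (var n) = σ n
subst σ (lam t) = lam (subst (exts σ) t)
subst σ (app t u) = app (subst σ t) (subst σ u)

subst0 : Term → ℕ → Term
subst0 v zero = v
subst0 v (suc n) = var n

_[_] : Term → Term → Term
t [ v ] = subst (subst0 v) t

data Root : Term → Term → Set where
  βv : (t v : Term) → Value v → Root (app (lam t) v) (t [ v ])

data LCtx : Set where
  hole : LCtx
  valL : (v : Term) → Value v → LCtx → LCtx
  ctxL : LCtx → Term → LCtx

plug : LCtx → Term → Term
plug hole t = t
plug (valL v _ L) t = app v (plug L t)
plug (ctxL L u) t = app (plug L t) u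

data _→l_ : Term → Term → Set where
  step : (L : LCtx) {t u : Term} → Root t u → plug L t →l plug L u

Normal : Term → Set
Normal t = ¬ (∃[ u ] (t →l u))

_⇓l_ : Term → Term → Set
t ⇓l n = Star _→l_ t n × Normal n

HasNF : Term → Set
HasNF t = ∃[ n ] (t ⇓l n)

wk-val : ∀ {w} → Value w → Value (rename suc w)
wk-val (var n) = var (suc n)
wk-val (lam t) = lam _

-- Weakening of a left context (makes room for a fresh variable z = index 0)
wkCtx : LCtx → LCtx
wkCtx hole = hole
wkCtx (valL v p L) = valL (rename suc v) (wk-val p) (wkCtx L)
wkCtx (ctxL L u) = ctxL (wkCtx L) (rename suc u)

plugFresh : LCtx → Term
plugFresh L = plug (wkCtx L) (var zero)

EnfSim : (Term → Term → Set) → Set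
EnfSim R = ∀ t t' → R t t' →
    (¬ HasNF t)
  ⊎ (∃[ x ] (t ⇓l var x × t' ⇓l var x))
  ⊎ (∃[ t₁ ] ∃[ t₁' ] (t ⇓l lam t₁ × t' ⇓l lam t₁' × R t₁ t₁'))
  ⊎ (∃[ L ] ∃[ L' ] ∃[ x ] ∃[ v ] ∃[ v' ]
       (Value v × Value v'
        × t ⇓l plug L (app (var x) v) × t' ⇓l plug L' (app (var x) v')
        × R v v' × R (plugFresh L) (plugFresh L')))

flipR : (Term → Term → Set) → Term → Term → Set
flipR R a b = R b a

_≃enf_ : Term → Term → Set₁
t ≃enf u = Σ (Term → Term → Set) λ R → R t u × EnfSim R × EnfSim (flipR R)

-- Ξ_v = λz.x(λy.zzy)  (x free, index 1 inside λz)
Ξv : Term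
Ξv = lam (app (var 1) (lam (app (app (var 1) (var 1)) (var 0))))

Yv : Term
Yv = lam (app Ξv Ξv)

Θhalf : Term
Θhalf = lam (lam (app (var 0) (lam (app (app (app (var 2) (var 2)) (var 1)) (var 0)))))

Θv : Term
Θv = app Θhalf Θhalf

-- Under λx, both fixed-point combinators unfold in lockstep:
--   Ξ_v Ξ_v →l x (λy. Ξ_v Ξ_v y)    and    Θ_v x →l* x (λy. Θ_v x y).
-- Relating the two sides of each unfolding, for every position of x
-- (de Bruijn shifts), together with the variables and the terms x y
-- produced by plugging the stuck contexts, gives an enf bisimulation.
-- Every term in it converges, so both directions come from one symmetric
-- description of how related terms converge.
module Submission where

open import Defs
open import Data.Nat using (ℕ; zero; suc)
open import Data.Product using (_×_; _,_; ∃-syntax)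
open import Data.Sum using (_⊎_; inj₁; inj₂)
open import Relation.Binary.PropositionalEquality using (_≡_; _≢_; refl)
open import Relation.Binary.Construct.Closure.ReflexiveTransitive using (Star; ε; _◅_)

_→l*_ : Term → Term → Set
_→l*_ = Star _→l_

data Stuck : Term → Set where
  var-app   : ∀ x {v} → Value v → Stuck (app (var x) v)
  stuck-app : ∀ {s} → Stuck s → ∀ t → Stuck (app s t)

normal-if-no-redex : ∀ {s} → (∀ L {t u} → Root t u → plug L t ≢ s) → Normal s
normal-if-no-redex no-redex (_ , step L r) = no-redex L r refl

value-no-redex : ∀ L {t u v} → Root t u → Value v → plug L t ≢ v
value-no-redex hole         (βv _ _ _) (var _) ()
value-no-redex hole         (βv _ _ _) (lam _) ()
value-no-redex (valL _ _ _) _          (var _) ()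
value-no-redex (valL _ _ _) _          (lam _) ()
value-no-redex (ctxL _ _)   _          (var _) ()
value-no-redex (ctxL _ _)   _          (lam _) ()

app-injectiveˡ : ∀ {a b c d : Term} → app a b ≡ app c d → a ≡ c
app-injectiveˡ refl = refl

stuck-no-redex : ∀ L {t u s} → Root t u → Stuck s → plug L t ≢ s
stuck-no-redex hole               (βv _ _ _) (var-app _ _)    ()
stuck-no-redex hole               (βv _ _ _) (stuck-app () _) refl
stuck-no-redex (valL _ _ L)       r          (var-app _ p)    refl = value-no-redex L r p refl
stuck-no-redex (valL _ (var _) _) _          (stuck-app () _) refl
stuck-no-redex (valL _ (lam _) _) _          (stuck-app () _) refl
stuck-no-redex (ctxL L _)         r          (var-app x _)    e    = value-no-redex L r (var x) (app-injectiveˡ e)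
stuck-no-redex (ctxL L _)         r          (stuck-app s _)  refl = stuck-no-redex L r s refl

value-normal : ∀ {v} → Value v → Normal v
value-normal p = normal-if-no-redex λ L r → value-no-redex L r p

stuck-normal : ∀ {s} → Stuck s → Normal s
stuck-normal p = normal-if-no-redex λ L r → stuck-no-redex L r p

⇓-value : ∀ {t v} → t →l* v → Value v → t ⇓l v
⇓-value t→*v p = t→*v , value-normal p

⇓-stuck : ∀ {t s} → t →l* s → Stuck s → t ⇓l s
⇓-stuck t→*s p = t→*s , stuck-normal p

-- The three convergent clauses of an enf simulation; unlike EnfSim, this
-- description is symmetric in the two terms.
EnfMatch : (Term → Term → Set) → Term → Term → Set
EnfMatch R t t' =
    (∃[ x ] (t ⇓l var x × t' ⇓l var x))
  ⊎ (∃[ t₁ ] ∃[ t₁' ] (t ⇓l lam t₁ × t' ⇓l lam t₁' × R t₁ t₁'))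
  ⊎ (∃[ L ] ∃[ L' ] ∃[ x ] ∃[ v ] ∃[ v' ]
       (Value v × Value v'
        × t ⇓l plug L (app (var x) v) × t' ⇓l plug L' (app (var x) v')
        × R v v' × R (plugFresh L) (plugFresh L')))

EnfMatch-flip : ∀ {R t t'} → EnfMatch R t t' → EnfMatch (flipR R) t' t
EnfMatch-flip (inj₁ (x , t⇓ , t'⇓)) = inj₁ (x , t'⇓ , t⇓)
EnfMatch-flip (inj₂ (inj₁ (t₁ , t₁' , t⇓ , t'⇓ , r))) = inj₂ (inj₁ (t₁' , t₁ , t'⇓ , t⇓ , r))
EnfMatch-flip (inj₂ (inj₂ (L , L' , x , v , v' , p , p' , t⇓ , t'⇓ , rv , rL))) =
  inj₂ (inj₂ (L' , L , x , v' , v , p' , p , t'⇓ , t⇓ , rv , rL))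

matching-enf-bisimulation : ∀ {R} → (∀ {t t'} → R t t' → EnfMatch R t t')
                          → EnfSim R × EnfSim (flipR R)
matching-enf-bisimulation match =
  (λ _ _ r → inj₂ (match r)) , (λ _ _ r → inj₂ (EnfMatch-flip (match r)))

-- Ξ n is Ξ_v with its free variable x at index n (so Ξv is Ξ 0).
Ξ : ℕ → Term
Ξ n = lam (app (var (suc n)) (lam (app (app (var 1) (var 1)) (var 0))))

Y-body : ℕ → Term
Y-body n = app (Ξ n) (Ξ n)

Y-unfold : ℕ → Term
Y-unfold n = lam (app (Y-body (suc n)) (var 0))

Θ-unfold : ℕ → Term
Θ-unfold n = lam (app (app Θv (var (suc n))) (var 0))

Θ-body : ℕ → Term
Θ-body n = app (var n) (Θ-unfold n)

Y-body-unfolds : ∀ n → Y-body n →l* app (var n) (Y-unfold n)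
Y-body-unfolds n = step hole (βv _ _ (lam _)) ◅ ε

Y-body-app-unfolds : ∀ n → app (Y-body (suc n)) (var 0) →l* app (app (var (suc n)) (Y-unfold (suc n))) (var 0)
Y-body-app-unfolds n = step (ctxL hole (var 0)) (βv _ _ (lam _)) ◅ ε

Θ-unfolds : Θv →l* lam (Θ-body 0)
Θ-unfolds = step hole (βv _ _ (lam _)) ◅ ε

Θ-app-unfolds : ∀ n → app (app Θv (var (suc n))) (var 0) →l* app (app (var (suc n)) (Θ-unfold (suc n))) (var 0)
Θ-app-unfolds n = step (ctxL (ctxL hole (var (suc n))) (var 0)) (βv _ _ (lam _))
                ◅ step (ctxL hole (var 0)) (βv _ _ (var _))
                ◅ ε

data _∼_ : Term → Term → Set where
  Y∼Θ           : Yv ∼ Θv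
  body∼body     : ∀ n → Y-body n ∼ Θ-body n
  unfold∼unfold : ∀ n → Y-unfold n ∼ Θ-unfold n
  app∼app       : ∀ n → app (Y-body (suc n)) (var 0) ∼ app (app Θv (var (suc n))) (var 0)
  var∼var       : ∀ x → var x ∼ var x
  var-app∼      : ∀ x y → app (var x) (var y) ∼ app (var x) (var y)

∼-match : ∀ {t t'} → t ∼ t' → EnfMatch _∼_ t t'
∼-match Y∼Θ = inj₂ (inj₁ (_ , _ , ⇓-value ε (lam _) , ⇓-value Θ-unfolds (lam _) , body∼body 0))
∼-match (body∼body n) =
  inj₂ (inj₂ (hole , hole , n , _ , _ , lam _ , lam _
             , ⇓-stuck (Y-body-unfolds n) (var-app n (lam _)) , ⇓-stuck ε (var-app n (lam _))
             , unfold∼unfold n , var∼var 0))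
∼-match (unfold∼unfold n) = inj₂ (inj₁ (_ , _ , ⇓-value ε (lam _) , ⇓-value ε (lam _) , app∼app n))
∼-match (app∼app n) =
  inj₂ (inj₂ (ctxL hole (var 0) , ctxL hole (var 0) , suc n , _ , _ , lam _ , lam _
             , ⇓-stuck (Y-body-app-unfolds n) (stuck-app (var-app (suc n) (lam _)) (var 0))
             , ⇓-stuck (Θ-app-unfolds n) (stuck-app (var-app (suc n) (lam _)) (var 0))
             , unfold∼unfold (suc n) , var-app∼ 0 1))
∼-match (var∼var x) = inj₁ (x , ⇓-value ε (var x) , ⇓-value ε (var x))
∼-match (var-app∼ x y) =
  inj₂ (inj₂ (hole , hole , x , var y , var y , var y , var y
             , ⇓-stuck ε (var-app x (var y)) , ⇓-stuck ε (var-app x (var y))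
             , var∼var y , var∼var 0))

proposition8p5 : Yv ≃enf Θv
proposition8p5 = _∼_ , Y∼Θ , matching-enf-bisimulation ∼-match
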